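{- Let $\mathbf{P}=(P_x,P_y)$ be a super pipe dream. (i) If $P_y=\varnothing$, then $X^+\mathbf{P}=\sigma(\mathbf{P})$ and $Y^+\mathbf{P}=\mathbf{P}$. If $P_x=\varnothing$, then $Y^+\mathbf{P}=\sigma^{ -1}(\mathbf{P})$ and $X^+\mathbf{P}=\mathbf{P}$. (ii) $X^+(\sigma(\mathbf{P}))=\sigma(X^+\mathbf{P})$ and $Y^+(\sigma(\mathbf{P}))=\sigma(Y^+\mathbf{P})$. (iii) $X^+(\mathbf{P}^\dagger)=(Y^+\mathbf{P})^\dagger$ and $Y^+(\mathbf{P}^\dagger)=(X^+\mathbf{P})^\dagger$.
   Context: Positions $(i,j)\in\mathbb{Z}^2$ have row index $i$ increasing downward and column index $j$ increasing rightward. A pipe dream is a finite subset of $\mathcal{H}=\{(i,j)\in\mathbb{Z}^2 : i+j-1\ge 1\}$; its word is obtained by reading the values $i+j-1$ of its elements right-to-left, starting with the top row and moving down, and its permutation is the product $e_{a_1}\cdots e_{a_p}$ of the word in the Demazure ($0$-Hecke) algebra (identified with a permutation). A super pipe dream is a pair $\mathbf{P}=(P_x,P_y)$ of pipe dreams, viewed as black checkers at $P_x$ and red checkers at $P_y$ (a position may hold one of each); its permutation is that of $P_x\cup P_y$, and $\mathrm{SPD}(w)$ denotes those with permutation $w$. Transpose: $P^t=\{(j,i):(i,j)\in P\}$; adjoint: $\mathbf{P}^\dagger=(P_y^t,P_x^t)$. Shift: $\sigma(P)=\{(i+1,j-1):(i,j)\in P\}$ and $\sigma(\mathbf{P})=(\sigma(P_x),\sigma(P_y))$.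 Flow operator $Y^+_j$ (defined on super pipe dreams with no red checkers in column $j+1$): take the lowest red checker in column $j$, at $(i,j)$. Case (a): if $(i,j+1)$ has no checker, let $(i',j)$ be the first position above $(i,j)$ with no checkers; in the $2$-column rectangle (ladder) with SW corner $(i,j)$ and NE corner $(i',j+1)$, move the red checker from $(i,j)$ to $(i',j+1)$, and in each intermediate row swap the checker(s) in column $j$ with those in column $j+1$. Case (b): if $(i,j+1)$ has a (black) checker, swap the checker(s) at $(i,j)$ with the checker at $(i,j+1)$. Repeat with the lowest remaining red checker in column $j$ until column $j$ has no red checkers. This is a permutation-preserving bijection onto super pipe dreams with no red checkers in column $j$, preserving the number of black checkers in each row. Set $Y^+_{\ge j}=Y^+_jY^+_{j+1}\cdots Y^+_M$ for $M$ large (all red checkers weakly west of column $M$), and $Y^+=Y^+_{\ge m}$ for $m$ small (all red checkers weakly east of column $m$); $Y^+$ flows every red checker one column to the right. Dually $X^+_i\mathbf{P}:=(Y^+_i(\mathbf{P}^\dagger))^\dagger$ flows black checkers from row $i$ into row $i+1$, and $X^+_{\ge i}=X^+_iX^+_{i+1}\cdots$, $X^+=X^+_{\ge m}$ for $m$ small, defined analogously. -}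

module Defs where

open import Data.Bool using (Bool; true; false; if_then_else_; _∧_; _∨_; not)
open import Data.Integer using (ℤ; _+_; _-_; +_; ∣_∣; _⊔_; _⊓_; _≤_; _<?_; _≟_)
open import Data.Nat using (ℕ; zero; suc)
import Data.Nat as ℕ
open import Data.List using (List; []; _∷_; map; length)
open import Data.Bool.ListAction using (any)
open import Data.List.Relation.Unary.All using (All)
open import Data.Product using (_×_; _,_; proj₁; proj₂)
open import Data.Maybe using (Maybe; just; nothing)
open import Relation.Nullary.Decidable using (⌊_⌋)
open import Data.List.Relation.Binary.BagAndSetEquality using (_∼[_]_; set)

-- (i , j) : row i (increasing downward), column j (increasing rightward)
Pos : Set
Pos = ℤ × ℤ

InH : Pos → Set
InH (i , j) = + 1 ≤ (i + j) - + 1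

-- A pipe dream is a finite subset of H, represented by a list of its
-- elements (duplicates are harmless: only membership matters).
PipeDream : Set
PipeDream = List Pos

IsPipeDream : PipeDream → Set
IsPipeDream P = All InH P

-- Super pipe dream: black checkers Px, red checkers Py.
record SPD : Set where
  constructor ⟨_,_⟩
  field
    Px : PipeDream
    Py : PipeDream
open SPD public

IsSPD : SPD → Set
IsSPD P = IsPipeDream (Px P) × IsPipeDream (Py P)

infix 4 _≋_
_≋_ : SPD → SPD → Set
P ≋ Q = (Px P ∼[ set ] Px Q) × (Py P ∼[ set ] Py Q)

transpose : PipeDream → PipeDream
transpose = map (λ { (i , j) → (j , i) })

infix 10 _†
_† : SPD → SPD
P † = ⟨ transpose (Py P) , transpose (Px P) ⟩

σₚ : PipeDream → PipeDream
σₚ = map (λ { (i , j) → (i + + 1 , j - + 1) })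

σ⁻¹ₚ : PipeDream → PipeDream
σ⁻¹ₚ = map (λ { (i , j) → (i - + 1 , j + + 1) })

σ : SPD → SPD
σ P = ⟨ σₚ (Px P) , σₚ (Py P) ⟩

σ⁻¹ : SPD → SPD
σ⁻¹ P = ⟨ σ⁻¹ₚ (Px P) , σ⁻¹ₚ (Py P) ⟩

infix 4 _==_ _<ᵇ_ _=ₚ_ _∈ᵇ_
_==_ : ℤ → ℤ → Bool
x == y = ⌊ x ≟ y ⌋

_<ᵇ_ : ℤ → ℤ → Bool
x <ᵇ y = ⌊ x <? y ⌋

_=ₚ_ : Pos → Pos → Bool
(a , b) =ₚ (c , d) = (a == c) ∧ (b == d)

_∈ᵇ_ : Pos → PipeDream → Bool
p ∈ᵇ P = any (λ q → q =ₚ p) P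

occupied : SPD → Pos → Bool
occupied P p = (p ∈ᵇ Px P) ∨ (p ∈ᵇ Py P)

maxM : Maybe ℤ → ℤ → Maybe ℤ
maxM nothing  x = just x
maxM (just y) x = just (y ⊔ x)

lowestRowInCol : ℤ → PipeDream → Maybe ℤ
lowestRowInCol j []            = nothing
lowestRowInCol j ((r , c) ∷ ps) =
  if c == j then maxM (lowestRowInCol j ps) r else lowestRowInCol j ps

-- first row r' ≤ r (scanning upward) with (r', j) empty; the fuel is
-- chosen large enough (number of checkers + 1) that an empty cell is found.
firstEmptyFrom : SPD → ℤ → ℤ → ℕ → ℤ
firstEmptyFrom P j r zero    = r
firstEmptyFrom P j r (suc n) =
  if occupied P (r , j) then firstEmptyFrom P j (r - + 1) n else r

swapLadder : ℤ → ℤ → ℤ → Pos → Pos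
swapLadder j lo hi (r , c) =
  if (lo <ᵇ r) ∧ (r <ᵇ hi)
  then (if c == j then (r , j + + 1)
        else if c == j + + 1 then (r , j) else (r , c))
  else (r , c)

swapRow : ℤ → ℤ → Pos → Pos
swapRow j i (r , c) =
  if r == i
  then (if c == j then (r , j + + 1)
        else if c == j + + 1 then (r , j) else (r , c))
  else (r , c)

Ystep : ℤ → ℤ → SPD → SPD
Ystep j i P =
  if occupied P (i , j + + 1)
  then
    ⟨ map (swapRow j i) (Px P) , map (swapRow j i) (Py P) ⟩
  else -- case (a): ladder with SW corner (i,j), NE corner (i',j+1)
    ⟨ map (swapLadder j i' i) (Px P) , map redMove (Py P) ⟩
  where
    i' : ℤ
    i' = firstEmptyFrom P j (i - + 1) (suc (length (Px P) ℕ.+ length (Py P)))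
    redMove : Pos → Pos
    redMove p = if p =ₚ (i , j) then (i' , j + + 1) else swapLadder j i' i p

-- repeat with the lowest remaining red checker in column j until there
-- is none (each step removes a red checker from column j, so the number
-- of red checkers is enough fuel)
Yloop : ℤ → ℕ → SPD → SPD
Yloop j zero    P = P
Yloop j (suc n) P with lowestRowInCol j (Py P)
... | nothing = P
... | just i  = Yloop j n (Ystep j i P)

Y⁺at : ℤ → SPD → SPD
Y⁺at j P = Yloop j (length (Py P)) P

Yfrom : ℤ → ℕ → SPD → SPD
Yfrom j zero    P = Y⁺at j P
Yfrom j (suc k) P = Y⁺at j (Yfrom (j + + 1) k P)

X⁺at : ℤ → SPD → SPD
X⁺at i P = (Y⁺at i (P †)) †

Xfrom : ℤ → ℕ → SPD → SPD
Xfrom i zero    P = X⁺at i P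
Xfrom i (suc k) P = X⁺at i (Xfrom (i + + 1) k P)

bounds : List ℤ → Maybe (ℤ × ℤ)
bounds []       = nothing
bounds (x ∷ xs) with bounds xs
... | nothing       = just (x , x)
... | just (m , M)  = just (x ⊓ m , x ⊔ M)

-- Y⁺ = Y⁺atm ⋯ Y⁺atM, with m = least and M = greatest column of a red
-- checker (any smaller m / larger M gives the same result, the extra
-- factors acting as the identity); identity if there are no red checkers.
Y⁺ : SPD → SPD
Y⁺ P with bounds (map proj₂ (Py P))
... | nothing      = P
... | just (m , M) = Yfrom m ∣ M - m ∣ P

X⁺ : SPD → SPD
X⁺ P with bounds (map proj₁ (Px P))
... | nothing      = P
... | just (m , M) = Xfrom m ∣ M - m ∣ P

-- (ii) and (iii) hold on the nose, as equalities of lists: every ingredient of the flow operators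
-- (equality and order tests, ladder swaps, the upward scan for an empty cell, the lowest checker of
-- a column, the range of occupied columns) commutes with translations of the plane, and X⁺ is Y⁺
-- conjugated by the adjoint. For (i), the adjoint reduces both halves to a super pipe dream with
-- red checkers only. There case (a) of Y⁺_j always applies, and each ladder moves the maximal
-- vertical run of red checkers ending at the lowest one of column j one step north-east. So Y⁺_j
-- replaces column j by its σ⁻¹-image in column j + 1, and Y⁺ = Y⁺_m ⋯ Y⁺_M applies σ⁻¹ to all
-- of R.
module Submission where

open import Defs
open import Data.List using ([])
open import Data.Product using (_×_)
open import Relation.Binary.PropositionalEquality using (_≡_)

open import Data.Bool using (true; false; _∧_; _∨_; if_then_else_)
open import Data.Integer using (ℤ; _+_; _-_; +_; -_; ∣_∣; _≤_; _<_; _⊔_; _≟_; _≤?_; _<?_)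
import Data.Integer.Properties as ℤP
open import Data.Integer.Tactic.RingSolver using (solve-∀)
open import Algebra.Properties.CommutativeSemigroup ℤP.+-commutativeSemigroup using (xy∙z≈xz∙y)
open import Data.List using (List; _∷_; map; length; filter)
import Data.List.Properties as List
open import Data.List.Membership.Propositional using (_∈_; _∉_; lose)
open import Data.List.Membership.Propositional.Properties using (∈-map⁺; ∈-map⁻)
open import Data.List.Relation.Binary.BagAndSetEquality using (set; [_]-Equality; map-cong)
open import Data.List.Relation.Unary.Any using (here; there)
open import Data.Maybe using (Maybe; just; nothing)
import Data.Maybe as Maybe
open import Data.Nat as ℕ using (ℕ; zero; suc)
import Data.Nat.Properties as ℕP
open import Data.Product using (Σ; _,_; proj₁; proj₂)
open import Data.Sum using (inj₁; inj₂)
open import Function using (_∘_)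
open import Function.Bundles using (_⇔_; mk⇔; Equivalence)
open import Function.Properties.Equivalence using () renaming (trans to ⇔-trans)
open import Relation.Binary.Bundles using (Setoid)
open import Relation.Binary.PropositionalEquality
  using (_≢_; refl; sym; trans; cong; cong₂; subst; subst₂; module ≡-Reasoning)
open import Relation.Nullary using (Dec; yes; no; ¬_; contradiction)
open import Relation.Nullary.Decidable using (⌊_⌋; _×-dec_)
open import Relation.Nullary.Reflects using (Reflects; ofʸ; ofⁿ; _×-reflects_; det)
open import Relation.Unary using (Decidable)

open Equivalence using (to; from)

⌊⌋-reflects : ∀ {A : Set} (a? : Dec A) → Reflects A ⌊ a? ⌋
⌊⌋-reflects (yes a) = ofʸ a
⌊⌋-reflects (no ¬a) = ofⁿ ¬a

reflects-⇔ : ∀ {A B : Set} {b} → A ⇔ B → Reflects A b → Reflects B b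
reflects-⇔ A⇔B (ofʸ a)  = ofʸ (to A⇔B a)
reflects-⇔ A⇔B (ofⁿ ¬a) = ofⁿ (¬a ∘ from A⇔B)

==-reflects : ∀ x y → Reflects (x ≡ y) (x == y)
==-reflects x y = ⌊⌋-reflects (x ≟ y)

<ᵇ-reflects : ∀ x y → Reflects (x < y) (x <ᵇ y)
<ᵇ-reflects x y = ⌊⌋-reflects (x <? y)

=ₚ-reflects : ∀ p q → Reflects (p ≡ q) (p =ₚ q)
=ₚ-reflects (a , b) (c , d) =
  reflects-⇔ (mk⇔ (λ (a≡c , b≡d) → cong₂ _,_ a≡c b≡d) (λ { refl → refl , refl }))
             (==-reflects a c ×-reflects ==-reflects b d)

∈ᵇ-reflects : ∀ p L → Reflects (p ∈ L) (p ∈ᵇ L)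
∈ᵇ-reflects p [] = ofⁿ λ ()
∈ᵇ-reflects p (q ∷ L) with q =ₚ p | =ₚ-reflects q p
... | true  | ofʸ refl = ofʸ (here refl)
... | false | ofⁿ q≢p with p ∈ᵇ L | ∈ᵇ-reflects p L
...   | true  | ofʸ p∈L = ofʸ (there p∈L)
...   | false | ofⁿ p∉L = ofⁿ λ { (here refl) → q≢p refl ; (there p∈L) → p∉L p∈L }

x+c-c≡x : ∀ x c → x + c - c ≡ x
x+c-c≡x = solve-∀

i+1-1≡i : ∀ i → i + + 1 - + 1 ≡ i
i+1-1≡i = solve-∀

i-1+1≡i : ∀ i → i - + 1 + + 1 ≡ i
i-1+1≡i = solve-∀

m+[M-m]≡M : ∀ m M → m + (M - m) ≡ M
m+[M-m]≡M = solve-∀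

M+c-[m+c]≡M-m : ∀ M m c → M + c - (m + c) ≡ M - m
M+c-[m+c]≡M-m = solve-∀

+-cancelʳ-≡ : ∀ c {x y} → x + c ≡ y + c → x ≡ y
+-cancelʳ-≡ c {x} {y} eq = trans (sym (x+c-c≡x x c)) (trans (cong (_- c) eq) (x+c-c≡x y c))

+-cancelʳ-< : ∀ c {x y} → x + c < y + c → x < y
+-cancelʳ-< c {x} {y} lt = subst₂ _<_ (x+c-c≡x x c) (x+c-c≡x y c) (ℤP.+-monoˡ-< (- c) lt)

<⇒+1≤ : ∀ {i j} → i < j → i + + 1 ≤ j
<⇒+1≤ {i} i<j = subst (_≤ _) (ℤP.+-comm (+ 1) i) (ℤP.i<j⇒suc[i]≤j i<j)

+1≤⇒< : ∀ {i j} → i + + 1 ≤ j → i < j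
+1≤⇒< {i} i+1≤j = ℤP.suc[i]≤j⇒i<j (subst (_≤ _) (ℤP.+-comm i (+ 1)) i+1≤j)

<⇒≤-1 : ∀ {i j} → i < j → i ≤ j - + 1
<⇒≤-1 {i} {j} i<j = subst (i ≤_) (ℤP.+-comm (- + 1) j) (ℤP.i<j⇒i≤pred[j] i<j)

≤-1⇒< : ∀ {i j} → i ≤ j - + 1 → i < j
≤-1⇒< {i} {j} i≤j-1 = ℤP.i≤pred[j]⇒i<j (subst (i ≤_) (ℤP.+-comm j (- + 1)) i≤j-1)

<+1⇒≤ : ∀ {i j} → i < j + + 1 → i ≤ j
<+1⇒≤ {i} {j} i<j+1 = subst (i ≤_) (i+1-1≡i j) (<⇒≤-1 i<j+1)

i<i+1 : ∀ i → i < i + + 1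
i<i+1 i = +1≤⇒< ℤP.≤-refl

i-1<i : ∀ i → i - + 1 < i
i-1<i i = ≤-1⇒< ℤP.≤-refl

j+1≢j : ∀ j → j + + 1 ≢ j
j+1≢j j j+1≡j = ℤP.<-irrefl (sym j+1≡j) (i<i+1 j)

translate : ℤ → ℤ → Pos → Pos
translate a b (i , j) = (i + a , j + b)

translateₚ : ℤ → ℤ → PipeDream → PipeDream
translateₚ a b = map (translate a b)

translateₛ : ℤ → ℤ → SPD → SPD
translateₛ a b P = ⟨ translateₚ a b (Px P) , translateₚ a b (Py P) ⟩

map-square : ∀ {A B C D : Set} {f : B → D} {h : A → B} {k : C → D} {g : A → C} →
  (∀ p → f (h p) ≡ k (g p)) → ∀ L → map f (map h L) ≡ map k (map g L)
map-square square L = trans (sym (List.map-∘ L)) (trans (List.map-cong square L) (List.map-∘ L))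

-- The local definitions of Ystep, which Defs does not export.
ladderTop : SPD → ℤ → ℤ → ℤ
ladderTop P j i = firstEmptyFrom P j (i - + 1) (suc (length (Px P) ℕ.+ length (Py P)))

redMove : ℤ → ℤ → ℤ → Pos → Pos
redMove j i i' p = if p =ₚ (i , j) then (i' , j + + 1) else swapLadder j i' i p

==-translate : ∀ c x y → (x + c == y + c) ≡ (x == y)
==-translate c x y =
  det (reflects-⇔ (mk⇔ (+-cancelʳ-≡ c) (cong (_+ c))) (==-reflects (x + c) (y + c)))
      (==-reflects x y)

<ᵇ-translate : ∀ c x y → (x + c <ᵇ y + c) ≡ (x <ᵇ y)
<ᵇ-translate c x y =
  det (reflects-⇔ (mk⇔ (+-cancelʳ-< c) (ℤP.+-monoˡ-< c)) (<ᵇ-reflects (x + c) (y + c)))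
      (<ᵇ-reflects x y)

module _ (a b : ℤ) where

  =ₚ-translate : ∀ p q → (translate a b p =ₚ translate a b q) ≡ (p =ₚ q)
  =ₚ-translate (x , y) (z , w) rewrite ==-translate a x z | ==-translate b y w = refl

  ∈ᵇ-translate : ∀ p L → (translate a b p ∈ᵇ translateₚ a b L) ≡ (p ∈ᵇ L)
  ∈ᵇ-translate p []      = refl
  ∈ᵇ-translate p (q ∷ L) = cong₂ _∨_ (=ₚ-translate q p) (∈ᵇ-translate p L)

  occupied-translate : ∀ P x y → occupied (translateₛ a b P) (x + a , y + b) ≡ occupied P (x , y)
  occupied-translate P x y =
    cong₂ _∨_ (∈ᵇ-translate (x , y) (Px P)) (∈ᵇ-translate (x , y) (Py P))

  occupied-east-translate : ∀ P j i →
    occupied (translateₛ a b P) (i + a , j + b + + 1) ≡ occupied P (i , j + + 1)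
  occupied-east-translate P j i =
    trans (cong (λ y → occupied (translateₛ a b P) (i + a , y)) (xy∙z≈xz∙y j b (+ 1)))
          (occupied-translate P i (j + + 1))

  swapRow-translate : ∀ j i p →
    swapRow (j + b) (i + a) (translate a b p) ≡ translate a b (swapRow j i p)
  swapRow-translate j i (r , c)
    rewrite ==-translate a r i | ==-translate b c j
          | xy∙z≈xz∙y j b (+ 1) | ==-translate b c (j + + 1)
    with r == i | c == j | c == j + + 1
  ... | false | _     | _     = refl
  ... | true  | true  | _     = refl
  ... | true  | false | true  = refl
  ... | true  | false | false = refl

  swapLadder-translate : ∀ j lo hi p →
    swapLadder (j + b) (lo + a) (hi + a) (translate a b p) ≡ translate a b (swapLadder j lo hi p)
  swapLadder-translate j lo hi (r , c)
    rewrite <ᵇ-translate a lo r | <ᵇ-translate a r hi | ==-translate b c j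
          | xy∙z≈xz∙y j b (+ 1) | ==-translate b c (j + + 1)
    with (lo <ᵇ r) ∧ (r <ᵇ hi) | c == j | c == j + + 1
  ... | false | _     | _     = refl
  ... | true  | true  | _     = refl
  ... | true  | false | true  = refl
  ... | true  | false | false = refl

  firstEmptyFrom-translate : ∀ P j r n →
    firstEmptyFrom (translateₛ a b P) (j + b) (r + a) n ≡ firstEmptyFrom P j r n + a
  firstEmptyFrom-translate P j r zero = refl
  firstEmptyFrom-translate P j r (suc n) rewrite occupied-translate P r j with occupied P (r , j)
  ... | true  rewrite xy∙z≈xz∙y r a (- + 1) = firstEmptyFrom-translate P j (r - + 1) n
  ... | false = refl

  lowestRowInCol-translate : ∀ j L →
    lowestRowInCol (j + b) (translateₚ a b L) ≡ Maybe.map (_+ a) (lowestRowInCol j L)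
  lowestRowInCol-translate j [] = refl
  lowestRowInCol-translate j ((r , c) ∷ L)
    rewrite ==-translate b c j | lowestRowInCol-translate j L
    with c == j
  ... | false = refl
  ... | true with lowestRowInCol j L
  ...   | nothing = refl
  ...   | just y  = cong just (sym (ℤP.mono-<-distrib-⊔ (_+ a) (ℤP.+-monoˡ-< a) y r))

  ladderTop-translate : ∀ P j i →
    ladderTop (translateₛ a b P) (j + b) (i + a) ≡ ladderTop P j i + a
  ladderTop-translate P j i
    rewrite List.length-map (translate a b) (Px P) | List.length-map (translate a b) (Py P)
          | xy∙z≈xz∙y i a (- + 1)
    = firstEmptyFrom-translate P j (i - + 1) (suc (length (Px P) ℕ.+ length (Py P)))

  redMove-translate : ∀ j i i' p →
    redMove (j + b) (i + a) (i' + a) (translate a b p) ≡ translate a b (redMove j i i' p)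
  redMove-translate j i i' p rewrite =ₚ-translate p (i , j) with p =ₚ (i , j)
  ... | true  = cong (i' + a ,_) (xy∙z≈xz∙y j b (+ 1))
  ... | false = swapLadder-translate j i' i p

  Ystep-translate : ∀ j i P →
    Ystep (j + b) (i + a) (translateₛ a b P) ≡ translateₛ a b (Ystep j i P)
  Ystep-translate j i P rewrite occupied-east-translate P j i with occupied P (i , j + + 1)
  ... | true  = cong₂ ⟨_,_⟩ (map-square (swapRow-translate j i) (Px P))
                            (map-square (swapRow-translate j i) (Py P))
  ... | false rewrite ladderTop-translate P j i =
    cong₂ ⟨_,_⟩ (map-square (swapLadder-translate j (ladderTop P j i) i) (Px P))
                (map-square (redMove-translate j i (ladderTop P j i)) (Py P))

  Yloop-translate : ∀ j n P → Yloop (j + b) n (translateₛ a b P) ≡ translateₛ a b (Yloop j n P)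
  Yloop-translate j zero    P = refl
  Yloop-translate j (suc n) P
    rewrite lowestRowInCol-translate j (Py P)
    with lowestRowInCol j (Py P)
  ... | nothing = refl
  ... | just i rewrite Ystep-translate j i P = Yloop-translate j n (Ystep j i P)

  Y⁺at-translate : ∀ j P → Y⁺at (j + b) (translateₛ a b P) ≡ translateₛ a b (Y⁺at j P)
  Y⁺at-translate j P rewrite List.length-map (translate a b) (Py P) =
    Yloop-translate j (length (Py P)) P

  Yfrom-translate : ∀ j k P → Yfrom (j + b) k (translateₛ a b P) ≡ translateₛ a b (Yfrom j k P)
  Yfrom-translate j zero    P = Y⁺at-translate j P
  Yfrom-translate j (suc k) P rewrite xy∙z≈xz∙y j b (+ 1) | Yfrom-translate (j + + 1) k P =
    Y⁺at-translate j (Yfrom (j + + 1) k P)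

transpose-translate : ∀ a b L → transpose (translateₚ a b L) ≡ translateₚ b a (transpose L)
transpose-translate a b = map-square λ _ → refl

†-translate : ∀ a b P → (translateₛ a b P) † ≡ translateₛ b a (P †)
†-translate a b P = cong₂ ⟨_,_⟩ (transpose-translate a b (Py P)) (transpose-translate a b (Px P))

X⁺at-translate : ∀ a b i P → X⁺at (i + a) (translateₛ a b P) ≡ translateₛ a b (X⁺at i P)
X⁺at-translate a b i P = begin
  (Y⁺at (i + a) ((translateₛ a b P) †)) † ≡⟨ cong (λ Q → (Y⁺at (i + a) Q) †) (†-translate a b P) ⟩
  (Y⁺at (i + a) (translateₛ b a (P †))) † ≡⟨ cong _† (Y⁺at-translate b a i (P †)) ⟩
  (translateₛ b a (Y⁺at i (P †))) †       ≡⟨ †-translate b a (Y⁺at i (P †)) ⟩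
  translateₛ a b (X⁺at i P)               ∎
  where open ≡-Reasoning

Xfrom-translate : ∀ a b i k P → Xfrom (i + a) k (translateₛ a b P) ≡ translateₛ a b (Xfrom i k P)
Xfrom-translate a b i zero    P = X⁺at-translate a b i P
Xfrom-translate a b i (suc k) P rewrite xy∙z≈xz∙y i a (+ 1) | Xfrom-translate a b (i + + 1) k P =
  X⁺at-translate a b i (Xfrom (i + + 1) k P)

bounds-+ : ∀ c xs → bounds (map (_+ c) xs) ≡ Maybe.map (λ (m , M) → (m + c , M + c)) (bounds xs)
bounds-+ c [] = refl
bounds-+ c (x ∷ xs) rewrite bounds-+ c xs with bounds xs
... | nothing      = refl
... | just (m , M) = cong just (cong₂ _,_ (sym (ℤP.mono-≤-distrib-⊓ (ℤP.+-monoˡ-≤ c) x m))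
                                          (sym (ℤP.mono-≤-distrib-⊔ (ℤP.+-monoˡ-≤ c) x M)))

rows-translate : ∀ a b L → map proj₁ (translateₚ a b L) ≡ map (_+ a) (map proj₁ L)
rows-translate a b = map-square λ _ → refl

columns-translate : ∀ a b L → map proj₂ (translateₚ a b L) ≡ map (_+ b) (map proj₂ L)
columns-translate a b = map-square λ _ → refl

Y⁺-translate : ∀ a b P → Y⁺ (translateₛ a b P) ≡ translateₛ a b (Y⁺ P)
Y⁺-translate a b P
  rewrite columns-translate a b (Py P) | bounds-+ b (map proj₂ (Py P))
  with bounds (map proj₂ (Py P))
... | nothing      = refl
... | just (m , M) rewrite M+c-[m+c]≡M-m M m b = Yfrom-translate a b m ∣ M - m ∣ P

X⁺-translate : ∀ a b P → X⁺ (translateₛ a b P) ≡ translateₛ a b (X⁺ P)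
X⁺-translate a b P
  rewrite rows-translate a b (Px P) | bounds-+ a (map proj₁ (Px P))
  with bounds (map proj₁ (Px P))
... | nothing      = refl
... | just (m , M) rewrite M+c-[m+c]≡M-m M m a = Xfrom-translate a b m ∣ M - m ∣ P

σ≡translate : ∀ P → σ P ≡ translateₛ (+ 1) (- + 1) P
σ≡translate P = cong₂ ⟨_,_⟩ (List.map-cong (λ _ → refl) (Px P)) (List.map-cong (λ _ → refl) (Py P))

Y⁺-σ : ∀ P → Y⁺ (σ P) ≡ σ (Y⁺ P)
Y⁺-σ P rewrite σ≡translate P | σ≡translate (Y⁺ P) = Y⁺-translate (+ 1) (- + 1) P

X⁺-σ : ∀ P → X⁺ (σ P) ≡ σ (X⁺ P)
X⁺-σ P rewrite σ≡translate P | σ≡translate (X⁺ P) = X⁺-translate (+ 1) (- + 1) P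

transpose-involutive : ∀ L → transpose (transpose L) ≡ L
transpose-involutive L = trans (sym (List.map-∘ L)) (List.map-id L)

†-involutive : ∀ P → P † † ≡ P
†-involutive ⟨ B , R ⟩ = cong₂ ⟨_,_⟩ (transpose-involutive B) (transpose-involutive R)

X⁺at-† : ∀ i P → X⁺at i (P †) ≡ (Y⁺at i P) †
X⁺at-† i P = cong (λ Q → (Y⁺at i Q) †) (†-involutive P)

Y⁺at-† : ∀ j P → Y⁺at j (P †) ≡ (X⁺at j P) †
Y⁺at-† j P = sym (†-involutive (Y⁺at j (P †)))

Xfrom-† : ∀ i k P → Xfrom i k (P †) ≡ (Yfrom i k P) †
Xfrom-† i zero    P = X⁺at-† i P
Xfrom-† i (suc k) P rewrite Xfrom-† (i + + 1) k P = X⁺at-† i (Yfrom (i + + 1) k P)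

Yfrom-† : ∀ j k P → Yfrom j k (P †) ≡ (Xfrom j k P) †
Yfrom-† j zero    P = Y⁺at-† j P
Yfrom-† j (suc k) P rewrite Yfrom-† (j + + 1) k P = Y⁺at-† j (Xfrom (j + + 1) k P)

rows-transpose : ∀ L → map proj₁ (transpose L) ≡ map proj₂ L
rows-transpose L = sym (List.map-∘ L)

columns-transpose : ∀ L → map proj₂ (transpose L) ≡ map proj₁ L
columns-transpose L = sym (List.map-∘ L)

X⁺-† : ∀ P → X⁺ (P †) ≡ (Y⁺ P) †
X⁺-† P rewrite rows-transpose (Py P) with bounds (map proj₂ (Py P))
... | nothing      = refl
... | just (m , M) = Xfrom-† m ∣ M - m ∣ P

Y⁺-† : ∀ P → Y⁺ (P †) ≡ (X⁺ P) †
Y⁺-† P rewrite columns-transpose (Px P) with bounds (map proj₁ (Px P))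
... | nothing      = refl
... | just (m , M) = Yfrom-† m ∣ M - m ∣ P

X⁺≡†Y⁺† : ∀ P → X⁺ P ≡ (Y⁺ (P †)) †
X⁺≡†Y⁺† P = trans (sym (†-involutive (X⁺ P))) (cong _† (sym (Y⁺-† P)))

module _ {A : Set} {P Q : A → Set} (P? : Decidable P) (Q? : Decidable Q)
         (P⇒Q : ∀ {z} → P z → Q z) where

  length-filter-mono : ∀ xs → length (filter P? xs) ℕ.≤ length (filter Q? xs)
  length-filter-mono []       = ℕ.z≤n
  length-filter-mono (x ∷ xs) with P? x | Q? x
  ... | yes _  | yes _  = ℕ.s≤s (length-filter-mono xs)
  ... | yes px | no ¬qx = contradiction (P⇒Q px) ¬qx
  ... | no _   | yes _  = ℕP.m≤n⇒m≤1+n (length-filter-mono xs)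
  ... | no _   | no _   = length-filter-mono xs

  length-filter-strict : ∀ {z xs} → z ∈ xs → Q z → ¬ P z →
                         length (filter P? xs) ℕ.< length (filter Q? xs)
  length-filter-strict {z} {_ ∷ xs} (here refl) qz ¬pz with P? z | Q? z
  ... | yes pz | _      = contradiction pz ¬pz
  ... | no _   | yes _  = ℕ.s≤s (length-filter-mono xs)
  ... | no _   | no ¬qz = contradiction qz ¬qz
  length-filter-strict {z} {x ∷ xs} (there z∈xs) qz ¬pz with P? x | Q? x
  ... | yes _  | yes _  = ℕ.s≤s (length-filter-strict z∈xs qz ¬pz)
  ... | yes px | no ¬qx = contradiction (P⇒Q px) ¬qx
  ... | no _   | yes _  = ℕP.m≤n⇒m≤1+n (length-filter-strict z∈xs qz ¬pz)
  ... | no _   | no _   = length-filter-strict z∈xs qz ¬pz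

module ColumnScan (L : PipeDream) (j : ℤ) where

  InColumnBetween : ℤ → ℤ → Pos → Set
  InColumnBetween lo hi (x , c) = c ≡ j × lo ≤ x × x ≤ hi

  inColumnBetween? : ∀ lo hi → Decidable (InColumnBetween lo hi)
  inColumnBetween? lo hi (x , c) = c ≟ j ×-dec lo ≤? x ×-dec x ≤? hi

  Filled : ℤ → ℤ → Set
  Filled lo hi = ∀ {x} → lo < x → x ≤ hi → (x , j) ∈ L

  filled-empty : ∀ s → Filled s s
  filled-empty s s<x x≤s = contradiction (ℤP.<-≤-trans s<x x≤s) (ℤP.<-irrefl refl)

  -- A scan that stops on an occupied cell has run out of fuel n, after passing n occupied cells.
  firstEmptyFrom-scan : ∀ n s → let i' = firstEmptyFrom ⟨ [] , L ⟩ j s n in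
    i' ≤ s × Filled i' s × ((i' , j) ∈ L → n ℕ.< length (filter (inColumnBetween? i' s) L))
  firstEmptyFrom-scan zero s =
    ℤP.≤-refl , filled-empty s ,
    λ s∈L → List.filter-some (inColumnBetween? s s) (lose s∈L (refl , ℤP.≤-refl , ℤP.≤-refl))
  firstEmptyFrom-scan (suc n) s with (s , j) ∈ᵇ L | ∈ᵇ-reflects (s , j) L
  ... | false | ofⁿ s∉L = ℤP.≤-refl , filled-empty s , λ s∈L → contradiction s∈L s∉L
  ... | true  | ofʸ s∈L with firstEmptyFrom ⟨ [] , L ⟩ j (s - + 1) n | firstEmptyFrom-scan n (s - + 1)
  ...   | i' | i'≤s-1 , filled , counted = i'≤s , filled′ , counted′
    where
    i'≤s : i' ≤ s
    i'≤s = ℤP.≤-trans i'≤s-1 (ℤP.<⇒≤ (i-1<i s))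
    filled′ : Filled i' s
    filled′ {x} i'<x x≤s with x ≟ s
    ... | yes refl = s∈L
    ... | no x≢s   = filled i'<x (<⇒≤-1 (ℤP.≤∧≢⇒< x≤s x≢s))
    counted′ : (i' , j) ∈ L → suc n ℕ.< length (filter (inColumnBetween? i' s) L)
    counted′ i'∈L = ℕP.≤-<-trans (counted i'∈L)
      (length-filter-strict (inColumnBetween? i' (s - + 1)) (inColumnBetween? i' s)
        (λ (c≡j , i'≤x , x≤s-1) → c≡j , i'≤x , ℤP.≤-trans x≤s-1 (ℤP.<⇒≤ (i-1<i s)))
        s∈L (refl , i'≤s , ℤP.≤-refl)
        (λ (_ , _ , s≤s-1) → ℤP.<-irrefl refl (ℤP.≤-<-trans s≤s-1 (i-1<i s))))

  record Gap (s i' : ℤ) : Set where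
    field
      gap≤ : i' ≤ s
      filled : Filled i' s
      vacant : (i' , j) ∉ L

  firstEmptyFrom-gap : ∀ s → Gap s (firstEmptyFrom ⟨ [] , L ⟩ j s (suc (length L)))
  firstEmptyFrom-gap s with firstEmptyFrom-scan (suc (length L)) s
  ... | i'≤s , filled , counted = record
    { gap≤   = i'≤s
    ; filled = filled
    ; vacant = λ i'∈L → ℕP.<⇒≱ (counted i'∈L)
                                (ℕP.m≤n⇒m≤1+n (List.length-filter (inColumnBetween? _ s) L))
    }

data Lowest (j : ℤ) (L : PipeDream) : Maybe ℤ → Set where
  none   : (∀ {x} → (x , j) ∉ L) → Lowest j L nothing
  lowest : ∀ {r} → (r , j) ∈ L → (∀ {x} → (x , j) ∈ L → x ≤ r) → Lowest j L (just r)

lowestRowInCol-lowest : ∀ j L → Lowest j L (lowestRowInCol j L)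
lowestRowInCol-lowest j [] = none λ ()
lowestRowInCol-lowest j ((a , c) ∷ L) with c == j | ==-reflects c j
... | false | ofⁿ c≢j with lowestRowInCol j L | lowestRowInCol-lowest j L
...   | nothing | none ∉L =
  none λ { (here refl) → c≢j refl ; (there x∈L) → ∉L x∈L }
...   | just r  | lowest r∈L max =
  lowest (there r∈L) λ { (here refl) → contradiction refl c≢j ; (there x∈L) → max x∈L }
lowestRowInCol-lowest j ((a , c) ∷ L) | true | ofʸ refl
  with lowestRowInCol j L | lowestRowInCol-lowest j L
... | nothing | none ∉L =
  lowest (here refl) λ { (here refl) → ℤP.≤-refl ; (there x∈L) → contradiction x∈L ∉L }
... | just r  | lowest r∈L max =
  lowest r⊔a∈ λ { (here refl)  → ℤP.i≤j⊔i r a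
                ; (there x∈L) → ℤP.≤-trans (max x∈L) (ℤP.i≤i⊔j r a) }
  where
  r⊔a∈ : (r ⊔ a , c) ∈ (a , c) ∷ L
  r⊔a∈ with ℤP.⊔-sel r a
  ... | inj₁ r⊔a≡r rewrite r⊔a≡r = there r∈L
  ... | inj₂ r⊔a≡a rewrite r⊔a≡a = here refl

column-upper-bound : ∀ j L → Σ ℤ λ t → ∀ {x} → (x , j) ∈ L → x < t
column-upper-bound j L with lowestRowInCol j L | lowestRowInCol-lowest j L
... | nothing | none ∉L      = + 0 , λ x∈L → contradiction x∈L ∉L
... | just r  | lowest _ max = r + + 1 , λ x∈L → +1≤⇒< (ℤP.+-monoˡ-≤ (+ 1) (max x∈L))

module _ (j lo hi : ℤ) where

  swapLadder-north : ∀ {x} c → x ≤ lo → swapLadder j lo hi (x , c) ≡ (x , c)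
  swapLadder-north {x} c x≤lo rewrite det (<ᵇ-reflects lo x) (ofⁿ (ℤP.≤⇒≯ x≤lo)) = refl

  swapLadder-south : ∀ {x} c → hi ≤ x → swapLadder j lo hi (x , c) ≡ (x , c)
  swapLadder-south {x} c hi≤x rewrite det (<ᵇ-reflects x hi) (ofⁿ (ℤP.≤⇒≯ hi≤x)) with lo <ᵇ x
  ... | true  = refl
  ... | false = refl

  swapLadder-elsewhere : ∀ {x c} → c ≢ j → c ≢ j + + 1 → swapLadder j lo hi (x , c) ≡ (x , c)
  swapLadder-elsewhere {x} {c} c≢j c≢j+1
    rewrite det (==-reflects c j) (ofⁿ c≢j) | det (==-reflects c (j + + 1)) (ofⁿ c≢j+1)
    with (lo <ᵇ x) ∧ (x <ᵇ hi)
  ... | true  = refl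
  ... | false = refl

  swapLadder-west : ∀ {x} → lo < x → x < hi → swapLadder j lo hi (x , j) ≡ (x , j + + 1)
  swapLadder-west {x} lo<x x<hi
    rewrite det (<ᵇ-reflects lo x) (ofʸ lo<x) | det (<ᵇ-reflects x hi) (ofʸ x<hi)
          | det (==-reflects j j) (ofʸ refl)
    = refl

module _ (j i i' : ℤ) where

  redMove-corner : redMove j i i' (i , j) ≡ (i' , j + + 1)
  redMove-corner rewrite det (=ₚ-reflects (i , j) (i , j)) (ofʸ refl) = refl

  redMove-ladder : ∀ {q} → q ≢ (i , j) → redMove j i i' q ≡ swapLadder j i' i q
  redMove-ladder {q} q≢ij rewrite det (=ₚ-reflects q (i , j)) (ofⁿ q≢ij) = refl

Represents : (Pos → Set) → PipeDream → Set
Represents Φ L = ∀ {p} → p ∈ L ⇔ Φ p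

RedOnly : (Pos → Set) → SPD → Set
RedOnly Φ S = Px S ≡ [] × Represents Φ (Py S)

module ColumnFlow (j : ℤ) (L₀ : PipeDream) (east-empty : ∀ {x} → (x , j + + 1) ∉ L₀) where

  -- t is the top of the last ladder: the checkers of column j below it have moved north-east.
  data Flowing (t : ℤ) : Pos → Set where
    other   : ∀ {x c} → c ≢ j → (x , c) ∈ L₀ → Flowing t (x , c)
    waiting : ∀ {x} → x ≤ t → (x , j) ∈ L₀ → Flowing t (x , j)
    moved   : ∀ {x} → t ≤ x → (x + + 1 , j) ∈ L₀ → Flowing t (x , j + + 1)

  data Flowed : Pos → Set where
    other : ∀ {x c} → c ≢ j → (x , c) ∈ L₀ → Flowed (x , c)
    moved : ∀ {x} → (x + + 1 , j) ∈ L₀ → Flowed (x , j + + 1)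

  flowing-west : ∀ {t x c} → Flowing t (x , c) → c ≡ j → x ≤ t × (x , j) ∈ L₀
  flowing-west (other c≢j _)      c≡j   = contradiction c≡j c≢j
  flowing-west (waiting x≤t x∈L₀) _     = x≤t , x∈L₀
  flowing-west (moved _ _)        j+1≡j = contradiction j+1≡j (j+1≢j j)

  flowing-east : ∀ {t x c} → Flowing t (x , c) → c ≡ j + + 1 → t ≤ x × (x + + 1 , j) ∈ L₀
  flowing-east (other _ x∈L₀)      refl  = contradiction x∈L₀ east-empty
  flowing-east (waiting _ _)       j≡j+1 = contradiction (sym j≡j+1) (j+1≢j j)
  flowing-east (moved t≤x x+1∈L₀) _     = t≤x , x+1∈L₀

  InColumnUpTo : ℤ → Pos → Set
  InColumnUpTo t (x , c) = c ≡ j × x ≤ t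

  inColumnUpTo? : ∀ t → Decidable (InColumnUpTo t)
  inColumnUpTo? t (x , c) = c ≟ j ×-dec x ≤? t

  -- Every ladder lowers this count, so the fuel length L₀ of Y⁺at suffices.
  remaining : ℤ → ℕ
  remaining t = length (filter (inColumnUpTo? t) L₀)

  module Step {t L r} (rep : Represents (Flowing t) L) (r∈L : (r , j) ∈ L)
              (lowest : ∀ {x} → (x , j) ∈ L → x ≤ r) where

    r≤t : r ≤ t
    r≤t = proj₁ (flowing-west (to rep r∈L) refl)

    r∈L₀ : (r , j) ∈ L₀
    r∈L₀ = proj₂ (flowing-west (to rep r∈L) refl)

    east-vacant : (t , j) ∉ L₀ → (r , j + + 1) ∉ L
    east-vacant t∉L₀ r+∈L with ℤP.≤-antisym r≤t (proj₁ (flowing-east (to rep r+∈L) refl))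
    ... | refl = t∉L₀ r∈L₀

    module _ {i'} (gap : ColumnScan.Gap L j (r - + 1) i') where
      open ColumnScan.Gap gap

      i'<r : i' < r
      i'<r = ≤-1⇒< gap≤

      i'≤t : i' ≤ t
      i'≤t = ℤP.≤-trans (ℤP.<⇒≤ i'<r) r≤t

      column-between : ∀ {y} → i' < y → y ≤ r → (y , j) ∈ L₀
      column-between {y} i'<y y≤r with y ≟ r
      ... | yes refl = r∈L₀
      ... | no y≢r   =
        proj₂ (flowing-west (to rep (filled i'<y (<⇒≤-1 (ℤP.≤∧≢⇒< y≤r y≢r)))) refl)

      top∉L₀ : (i' , j) ∉ L₀
      top∉L₀ i'∈L₀ = vacant (from rep (waiting i'≤t i'∈L₀))

      remaining-decreases : remaining i' ℕ.< remaining t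
      remaining-decreases =
        length-filter-strict (inColumnUpTo? i') (inColumnUpTo? t)
          (λ (c≡j , x≤i') → c≡j , ℤP.≤-trans x≤i' i'≤t)
          r∈L₀ (refl , r≤t) (λ (_ , r≤i') → ℤP.<⇒≱ i'<r r≤i')

      move : Pos → Pos
      move = redMove j r i'

      lands : ∀ q {p} → move q ≡ p → Flowing i' p → Flowing i' (move q)
      lands _ move-q≡p = subst (Flowing i') (sym move-q≡p)

      moves-forward : ∀ {q} → q ∈ L → Flowing i' (move q)
      moves-forward q∈L with to rep q∈L
      ... | other {x} {c} c≢j q∈L₀ =
        lands (x , c)
              (trans (redMove-ladder j r i' (c≢j ∘ cong proj₂))
                     (swapLadder-elsewhere j i' r c≢j (λ { refl → east-empty q∈L₀ })))
              (other c≢j q∈L₀)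
      ... | moved {x} t≤x x+1∈L₀ =
        lands (x , j + + 1)
              (trans (redMove-ladder j r i' (j+1≢j j ∘ cong proj₂))
                     (swapLadder-south j i' r (j + + 1) (ℤP.≤-trans r≤t t≤x)))
              (moved (ℤP.≤-trans i'≤t t≤x) x+1∈L₀)
      ... | waiting {x} x≤t x∈L₀ with r ≟ x
      ...   | yes refl =
        lands (r , j) (redMove-corner j r i')
              (moved ℤP.≤-refl (column-between (i<i+1 i') (<⇒+1≤ i'<r)))
      ...   | no r≢x with x ≤? i' | ℤP.≤∧≢⇒< (lowest q∈L) (r≢x ∘ sym)
      ...     | yes x≤i' | _ =
        lands (x , j)
              (trans (redMove-ladder j r i' (r≢x ∘ sym ∘ cong proj₁)) (swapLadder-north j i' r j x≤i'))
              (waiting x≤i' x∈L₀)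
      ...     | no x≰i' | x<r =
        lands (x , j)
              (trans (redMove-ladder j r i' (r≢x ∘ sym ∘ cong proj₁)) (swapLadder-west j i' r i'<x x<r))
              (moved (ℤP.<⇒≤ i'<x) (column-between (ℤP.<-trans i'<x (i<i+1 x)) (<⇒+1≤ x<r)))
        where
        i'<x : i' < x
        i'<x = ℤP.≰⇒> x≰i'

      stays : ∀ {q} → q ∈ L → move q ≡ q → q ∈ map move L
      stays q∈L fixed = subst (_∈ map move L) fixed (∈-map⁺ move q∈L)

      moves-backward : ∀ {p} → Flowing i' p → p ∈ map move L
      moves-backward (other c≢j p∈L₀) =
        stays (from rep (other c≢j p∈L₀))
              (trans (redMove-ladder j r i' (c≢j ∘ cong proj₂))
                     (swapLadder-elsewhere j i' r c≢j (λ { refl → east-empty p∈L₀ })))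
      moves-backward (waiting x≤i' x∈L₀) =
        stays (from rep (waiting (ℤP.≤-trans x≤i' i'≤t) x∈L₀))
              (trans (redMove-ladder j r i' (ℤP.<⇒≢ (ℤP.≤-<-trans x≤i' i'<r) ∘ cong proj₁))
                     (swapLadder-north j i' r j x≤i'))
      moves-backward (moved {x} i'≤x x+1∈L₀) with t ≤? x
      ... | yes t≤x =
        stays (from rep (moved t≤x x+1∈L₀))
              (trans (redMove-ladder j r i' (j+1≢j j ∘ cong proj₂))
                     (swapLadder-south j i' r (j + + 1) (ℤP.≤-trans r≤t t≤x)))
      ... | no t≰x with x ≟ i'
      ...   | yes refl = subst (_∈ map move L) (redMove-corner j r x) (∈-map⁺ move r∈L)
      ...   | no x≢i' =
        subst (_∈ map move L)
              (trans (redMove-ladder j r i' (ℤP.<⇒≢ x<r ∘ cong proj₁)) (swapLadder-west j i' r i'<x x<r))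
              (∈-map⁺ move (filled i'<x (<⇒≤-1 x<r)))
        where
        x<r : x < r
        x<r = +1≤⇒< (lowest (from rep (waiting (<⇒+1≤ (ℤP.≰⇒> t≰x)) x+1∈L₀)))
        i'<x : i' < x
        i'<x = ℤP.≤∧≢⇒< i'≤x (x≢i' ∘ sym)

      represents : Represents (Flowing i') (map move L)
      represents = mk⇔ forward moves-backward
        where
        forward : ∀ {p} → p ∈ map move L → Flowing i' p
        forward p∈ with ∈-map⁻ move p∈
        ... | _ , q∈L , refl = moves-forward q∈L

  finished : ∀ {t L} → Represents (Flowing t) L → (∀ {x} → (x , j) ∉ L) → Represents Flowed L
  finished {t} {L} rep column-done = mk⇔ forward backward
    where
    forward : ∀ {p} → p ∈ L → Flowed p
    forward p∈L with to rep p∈L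
    ... | other c≢j p∈L₀ = other c≢j p∈L₀
    ... | waiting _ _    = contradiction p∈L column-done
    ... | moved _ x+1∈L₀ = moved x+1∈L₀
    backward : ∀ {p} → Flowed p → p ∈ L
    backward (other c≢j p∈L₀) = from rep (other c≢j p∈L₀)
    backward (moved {x} x+1∈L₀) with t ≤? x
    ... | yes t≤x = from rep (moved t≤x x+1∈L₀)
    ... | no t≰x  = contradiction (from rep (waiting (<⇒+1≤ (ℤP.≰⇒> t≰x)) x+1∈L₀)) column-done

  Yloop-Flowed : ∀ n t L → Represents (Flowing t) L → (t , j) ∉ L₀ → remaining t ℕ.≤ n →
                 RedOnly Flowed (Yloop j n ⟨ [] , L ⟩)
  Yloop-Flowed zero t L rep _ none-remaining = refl , finished rep column-done
    where
    column-done : ∀ {x} → (x , j) ∉ L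
    column-done x∈L with flowing-west (to rep x∈L) refl
    ... | x≤t , x∈L₀ =
      ℕP.<⇒≱ (List.filter-some (inColumnUpTo? t) (lose x∈L₀ (refl , x≤t))) none-remaining
  Yloop-Flowed (suc n) t L rep t∉L₀ bound with lowestRowInCol j L | lowestRowInCol-lowest j L
  ... | nothing | none column-done = refl , finished rep column-done
  ... | just r  | lowest r∈L max with (r , j + + 1) ∈ᵇ L | ∈ᵇ-reflects (r , j + + 1) L
  ...   | true  | ofʸ r+∈L = contradiction r+∈L (east-vacant t∉L₀)
    where open Step rep r∈L max
  ...   | false | ofⁿ _ =
    Yloop-Flowed n _ _ (represents gap) (top∉L₀ gap)
                 (ℕP.≤-pred (ℕP.≤-trans (remaining-decreases gap) bound))
    where
    open Step rep r∈L max
    gap = ColumnScan.firstEmptyFrom-gap L j (r - + 1)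

  start : ∀ t → (∀ {x} → (x , j) ∈ L₀ → x < t) → Represents (Flowing t) L₀
  start t below = mk⇔ forward backward
    where
    forward : ∀ {p} → p ∈ L₀ → Flowing t p
    forward {x , c} p∈L₀ with c ≟ j
    ... | yes refl = waiting (ℤP.<⇒≤ (below p∈L₀)) p∈L₀
    ... | no c≢j   = other c≢j p∈L₀
    backward : ∀ {p} → Flowing t p → p ∈ L₀
    backward (other _ p∈L₀)   = p∈L₀
    backward (waiting _ p∈L₀) = p∈L₀
    backward (moved {x} t≤x x+1∈L₀) =
      contradiction (ℤP.<-trans (ℤP.≤-<-trans t≤x (i<i+1 x)) (below x+1∈L₀)) (ℤP.<-irrefl refl)

  Y⁺at-Flowed : RedOnly Flowed (Y⁺at j ⟨ [] , L₀ ⟩)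
  Y⁺at-Flowed with column-upper-bound j L₀
  ... | t , below =
    Yloop-Flowed (length L₀) t L₀ (start t below) (λ t∈L₀ → ℤP.<-irrefl refl (below t∈L₀))
                 (List.length-filter (inColumnUpTo? t) L₀)

-- Y⁺_j ⋯ Y⁺_M applied to R: columns ≥ j shifted by σ⁻¹, the others untouched.
data FlowedFrom (j : ℤ) (R : PipeDream) : Pos → Set where
  west    : ∀ {x c} → c < j → (x , c) ∈ R → FlowedFrom j R (x , c)
  shifted : ∀ {x c} → j < c → (x + + 1 , c - + 1) ∈ R → FlowedFrom j R (x , c)

Y⁺at-FlowedFrom : ∀ j R {L} → Represents (FlowedFrom (j + + 1) R) L →
                  RedOnly (FlowedFrom j R) (Y⁺at j ⟨ [] , L ⟩)
Y⁺at-FlowedFrom j R {L} rep = proj₁ Y⁺at-Flowed , ⇔-trans (proj₂ Y⁺at-Flowed) (mk⇔ forward backward)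
  where
  east-empty : ∀ {x} → (x , j + + 1) ∉ L
  east-empty x∈L with to rep x∈L
  ... | west j+1<j+1 _    = ℤP.<-irrefl refl j+1<j+1
  ... | shifted j+1<j+1 _ = ℤP.<-irrefl refl j+1<j+1

  open ColumnFlow j L east-empty

  j+1-1≡j : j + + 1 - + 1 ≡ j
  j+1-1≡j = i+1-1≡i j

  forward : ∀ {p} → Flowed p → FlowedFrom j R p
  forward (other c≢j p∈L) with to rep p∈L
  ... | west c<j+1 p∈R    = west (ℤP.≤∧≢⇒< (<+1⇒≤ c<j+1) c≢j) p∈R
  ... | shifted j+1<c p∈R = shifted (ℤP.<-trans (i<i+1 j) j+1<c) p∈R
  forward (moved {x} x+1∈L) with to rep x+1∈L
  ... | west _ x+1∈R   = shifted (i<i+1 j) (subst (λ c → (x + + 1 , c) ∈ R) (sym j+1-1≡j) x+1∈R)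
  ... | shifted j+1<j _ = contradiction (ℤP.<-trans (i<i+1 j) j+1<j) (ℤP.<-irrefl refl)

  backward : ∀ {p} → FlowedFrom j R p → Flowed p
  backward (west c<j p∈R) =
    other (ℤP.<⇒≢ c<j) (from rep (west (ℤP.<-trans c<j (i<i+1 j)) p∈R))
  backward (shifted {x} {c} j<c q∈R) with c ≟ j + + 1
  ... | yes refl = moved (from rep (west (i<i+1 j) (subst (λ c → (x + + 1 , c) ∈ R) j+1-1≡j q∈R)))
  ... | no c≢j+1 =
    other (ℤP.<⇒≢ j<c ∘ sym) (from rep (shifted (ℤP.≤∧≢⇒< (<⇒+1≤ j<c) (c≢j+1 ∘ sym)) q∈R))

FlowedFrom-east-of : ∀ j R → (∀ {x c} → (x , c) ∈ R → c ≤ j) →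
                     Represents (FlowedFrom (j + + 1) R) R
FlowedFrom-east-of j R bounded = mk⇔ (λ p∈R → west (ℤP.≤-<-trans (bounded p∈R) (i<i+1 j)) p∈R) backward
  where
  backward : ∀ {p} → FlowedFrom (j + + 1) R p → p ∈ R
  backward (west _ p∈R)        = p∈R
  backward (shifted j+1<c q∈R) =
    contradiction (ℤP.≤-trans (<⇒≤-1 j+1<c) (bounded q∈R)) (ℤP.<⇒≱ (i<i+1 j))

Yfrom-FlowedFrom : ∀ k j R → (∀ {x c} → (x , c) ∈ R → c ≤ j + + k) →
                   RedOnly (FlowedFrom j R) (Yfrom j k ⟨ [] , R ⟩)
Yfrom-FlowedFrom zero j R bounded =
  Y⁺at-FlowedFrom j R (FlowedFrom-east-of j R (subst (_ ≤_) (ℤP.+-identityʳ j) ∘ bounded))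
Yfrom-FlowedFrom (suc k) j R bounded
  with Yfrom (j + + 1) k ⟨ [] , R ⟩
     | Yfrom-FlowedFrom k (j + + 1) R (subst (_ ≤_) (sym (ℤP.+-assoc j (+ 1) (+ k))) ∘ bounded)
... | ⟨ .[] , L ⟩ | refl , rep = Y⁺at-FlowedFrom j R rep

data Range (xs : List ℤ) : Maybe (ℤ × ℤ) → Set where
  empty : (∀ {c} → c ∉ xs) → Range xs nothing
  range : ∀ {m M} → m ≤ M → (∀ {c} → c ∈ xs → m ≤ c × c ≤ M) → Range xs (just (m , M))

bounds-range : ∀ xs → Range xs (bounds xs)
bounds-range [] = empty λ ()
bounds-range (x ∷ xs) with bounds xs | bounds-range xs
... | nothing | empty ∉xs =
  range ℤP.≤-refl λ { (here refl)   → ℤP.≤-refl , ℤP.≤-refl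
                    ; (there c∈xs) → contradiction c∈xs ∉xs }
... | just (m , M) | range m≤M within =
  range (ℤP.≤-trans (ℤP.i⊓j≤i x m) (ℤP.i≤i⊔j x M)) λ
    { (here refl)   → ℤP.i⊓j≤i x m , ℤP.i≤i⊔j x M
    ; (there c∈xs) → ℤP.≤-trans (ℤP.i⊓j≤j x m) (proj₁ (within c∈xs))
                    , ℤP.≤-trans (proj₂ (within c∈xs)) (ℤP.i≤j⊔i x M)
    }

∈-σ⁻¹ₚ : ∀ {x c} R → (x , c) ∈ σ⁻¹ₚ R ⇔ (x + + 1 , c - + 1) ∈ R
∈-σ⁻¹ₚ {x} {c} R = mk⇔ forward backward
  where
  forward : (x , c) ∈ σ⁻¹ₚ R → (x + + 1 , c - + 1) ∈ R
  forward p∈ with ∈-map⁻ _ p∈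
  ... | (a , b) , q∈R , refl = subst (_∈ R) (sym (cong₂ _,_ (i-1+1≡i a) (i+1-1≡i b))) q∈R
  backward : (x + + 1 , c - + 1) ∈ R → (x , c) ∈ σ⁻¹ₚ R
  backward q∈R = subst (_∈ σ⁻¹ₚ R) (cong₂ _,_ (i+1-1≡i x) (i-1+1≡i c)) (∈-map⁺ _ q∈R)

Y⁺-red-only : ∀ R → RedOnly (_∈ σ⁻¹ₚ R) (Y⁺ ⟨ [] , R ⟩)
Y⁺-red-only R with bounds (map proj₂ R) | bounds-range (map proj₂ R)
... | nothing | empty no-column =
  refl , mk⇔ (λ p∈R → contradiction (∈-map⁺ proj₂ p∈R) no-column)
             (λ p∈ → contradiction (∈-map⁺ proj₂ (to (∈-σ⁻¹ₚ R) p∈)) no-column)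
... | just (m , M) | range m≤M within =
  proj₁ flowed , ⇔-trans (proj₂ flowed) (mk⇔ forward backward)
  where
  column-range : ∀ {p} → p ∈ R → m ≤ proj₂ p × proj₂ p ≤ M
  column-range = within ∘ ∈-map⁺ proj₂
  flowed : RedOnly (FlowedFrom m R) (Yfrom m ∣ M - m ∣ ⟨ [] , R ⟩)
  flowed = Yfrom-FlowedFrom ∣ M - m ∣ m R λ p∈R →
    subst (_ ≤_) (sym (trans (cong (_+_ m) (ℤP.0≤i⇒+∣i∣≡i (ℤP.i≤j⇒0≤j-i m≤M)))
                             (m+[M-m]≡M m M)))
          (proj₂ (column-range p∈R))
  forward : ∀ {p} → FlowedFrom m R p → p ∈ σ⁻¹ₚ R
  forward (west c<m p∈R)  = contradiction (proj₁ (column-range p∈R)) (ℤP.<⇒≱ c<m)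
  forward (shifted _ q∈R) = from (∈-σ⁻¹ₚ R) q∈R
  backward : ∀ {p} → p ∈ σ⁻¹ₚ R → FlowedFrom m R p
  backward p∈ = shifted (≤-1⇒< (proj₁ (column-range q∈R))) q∈R
    where q∈R = to (∈-σ⁻¹ₚ R) p∈

module ∼ = Setoid ([ set ]-Equality Pos)

≡⇒≋ : ∀ {P Q} → P ≡ Q → P ≋ Q
≡⇒≋ refl = ∼.refl , ∼.refl

Y⁺-without-black : ∀ R → Y⁺ ⟨ [] , R ⟩ ≋ σ⁻¹ ⟨ [] , R ⟩
Y⁺-without-black R = ∼.reflexive (proj₁ (Y⁺-red-only R)) , proj₂ (Y⁺-red-only R)

transpose-σ⁻¹ₚ-transpose : ∀ B → transpose (σ⁻¹ₚ (transpose B)) ≡ σₚ B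
transpose-σ⁻¹ₚ-transpose B =
  trans (sym (List.map-∘ (transpose B))) (trans (sym (List.map-∘ B)) (List.map-cong (λ _ → refl) B))

X⁺-without-red : ∀ B → X⁺ ⟨ B , [] ⟩ ≋ σ ⟨ B , [] ⟩
X⁺-without-red B rewrite X⁺≡†Y⁺† ⟨ B , [] ⟩ =
  ∼.trans (map-cong (λ _ → refl) (proj₂ (Y⁺-red-only (transpose B))))
          (∼.reflexive (transpose-σ⁻¹ₚ-transpose B)) ,
  ∼.reflexive (cong transpose (proj₁ (Y⁺-red-only (transpose B))))

proposition4p3 : (P : SPD) → IsSPD P →
    ((Py P ≡ [] → (X⁺ P ≋ σ P) × (Y⁺ P ≋ P)) ×
     (Px P ≡ [] → (Y⁺ P ≋ σ⁻¹ P) × (X⁺ P ≋ P))) ×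
    ((X⁺ (σ P) ≋ σ (X⁺ P)) × (Y⁺ (σ P) ≋ σ (Y⁺ P))) ×
    ((X⁺ (P †) ≋ (Y⁺ P) †) × (Y⁺ (P †) ≋ (X⁺ P) †))
proposition4p3 P@(⟨ B , R ⟩) _ =
  ( (λ { refl → X⁺-without-red B , ≡⇒≋ refl })
  , (λ { refl → Y⁺-without-black R , ≡⇒≋ refl }) )
  , (≡⇒≋ (X⁺-σ P) , ≡⇒≋ (Y⁺-σ P))
  , (≡⇒≋ (X⁺-† P) , ≡⇒≋ (Y⁺-† P))
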